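{- Let $A$ be a residuated lattice and $(L,\lambda)$ a reticulation of $A$. Then for all $a\in A$, $\lambda(\langle a\rangle)=[\lambda(a))$, where $\langle a\rangle$ is the filter of $A$ generated by $a$ and $[\lambda(a))=\{l\in L\mid \lambda(a)\le l\}$ is the principal filter of $L$ generated by $\lambda(a)$.
   Context: A residuated lattice is an algebra $(A,\vee,\wedge,\odot,\rightarrow,0,1)$ such that $(A,\vee,\wedge,0,1)$ is a bounded lattice, $(A,\odot,1)$ is a commutative monoid, and for all $a,b,c\in A$: $a\le b\rightarrow c$ iff $a\odot b\le c$. Write $a^n=a\odot\cdots\odot a$ ($n$ factors). A filter of $A$ is a nonempty subset closed under $\odot$ and upward closed; the filter generated by $a$ is the least filter containing $a$, and equals $\{b\in A\mid \exists n\ge1,\ a^n\le b\}$. A reticulation of $A$ is a pair $(L,\lambda)$ with $L$ a bounded distributive lattice and $\lambda:A\to L$ a function such that: (1) $\lambda(a\odot b)=\lambda(a)\wedge\lambda(b)$; (2) $\lambda(a\vee b)=\lambda(a)\vee\lambda(b)$; (3) $\lambda(0)=0$, $\lambda(1)=1$; (4) $\lambda$ is surjective; (5) $\lambda(a)\le\lambda(b)$ iff there is $n\ge 1$ with $a^n\le b$. -}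

module Defs where

open import Level using (Level; _⊔_) renaming (suc to lsuc)
open import Data.Nat using (ℕ; zero; suc; _≥_)
open import Data.Product using (Σ; _×_; ∃; _,_)
open import Relation.Binary.PropositionalEquality using (_≡_)
open import Relation.Unary using (Pred)
open import Function.Bundles using (_⇔_)

record IsBoundedLattice {a} (A : Set a) (_∨_ _∧_ : A → A → A) (⊥ ⊤ : A) : Set a where
  field
    ∨-assoc : ∀ x y z → (x ∨ y) ∨ z ≡ x ∨ (y ∨ z)
    ∧-assoc : ∀ x y z → (x ∧ y) ∧ z ≡ x ∧ (y ∧ z)
    ∨-comm  : ∀ x y → x ∨ y ≡ y ∨ x
    ∧-comm  : ∀ x y → x ∧ y ≡ y ∧ x
    ∨-absorbs-∧ : ∀ x y → x ∨ (x ∧ y) ≡ x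
    ∧-absorbs-∨ : ∀ x y → x ∧ (x ∨ y) ≡ x
    ⊥-least   : ∀ x → ⊥ ∨ x ≡ x
    ⊤-greatest : ∀ x → x ∨ ⊤ ≡ ⊤

LatOrder : ∀ {a} {A : Set a} → (A → A → A) → A → A → Set a
LatOrder _∨_ x y = x ∨ y ≡ y

record ResiduatedLattice (a : Level) : Set (lsuc a) where
  field
    Carrier : Set a
    _∨_ _∧_ _⊙_ _⇒_ : Carrier → Carrier → Carrier
    𝟘 𝟙 : Carrier
    isBoundedLattice : IsBoundedLattice Carrier _∨_ _∧_ 𝟘 𝟙
    ⊙-assoc : ∀ x y z → (x ⊙ y) ⊙ z ≡ x ⊙ (y ⊙ z)
    ⊙-comm  : ∀ x y → x ⊙ y ≡ y ⊙ x
    ⊙-identityʳ : ∀ x → x ⊙ 𝟙 ≡ x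
    residuation : ∀ x y z → LatOrder _∨_ x (y ⇒ z) ⇔ LatOrder _∨_ (x ⊙ y) z

  _≤_ : Carrier → Carrier → Set a
  _≤_ = LatOrder _∨_

  _^_ : Carrier → ℕ → Carrier
  x ^ zero  = 𝟙
  x ^ suc n = x ⊙ (x ^ n)

  ⟨_⟩ : Carrier → Pred Carrier a
  ⟨ x ⟩ y = Σ ℕ λ n → n ≥ 1 × (x ^ n) ≤ y

record BoundedDistributiveLattice (ℓ : Level) : Set (lsuc ℓ) where
  field
    Carrier : Set ℓ
    _∨_ _∧_ : Carrier → Carrier → Carrier
    𝟘 𝟙 : Carrier
    isBoundedLattice : IsBoundedLattice Carrier _∨_ _∧_ 𝟘 𝟙
    ∧-distribˡ-∨ : ∀ x y z → x ∧ (y ∨ z) ≡ (x ∧ y) ∨ (x ∧ z)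

  _≤_ : Carrier → Carrier → Set ℓ
  _≤_ = LatOrder _∨_

  [_⟫ : Carrier → Pred Carrier ℓ
  [ x ⟫ y = x ≤ y

record IsReticulation {a ℓ} (A : ResiduatedLattice a) (L : BoundedDistributiveLattice ℓ)
       (lam : ResiduatedLattice.Carrier A → BoundedDistributiveLattice.Carrier L) : Set (a ⊔ ℓ) where
  private
    module A = ResiduatedLattice A
    module L = BoundedDistributiveLattice L
  field
    pres-⊙ : ∀ x y → lam (x A.⊙ y) ≡ lam x L.∧ lam y
    pres-∨ : ∀ x y → lam (x A.∨ y) ≡ lam x L.∨ lam y
    pres-𝟘 : lam A.𝟘 ≡ L.𝟘
    pres-𝟙 : lam A.𝟙 ≡ L.𝟙
    surjective : ∀ l → ∃ λ x → lam x ≡ l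
    order : ∀ x y → (lam x L.≤ lam y) ⇔ (Σ ℕ λ n → n ≥ 1 × (x A.^ n) A.≤ y)

image : ∀ {a b ℓ} {X : Set a} {Y : Set b} → (X → Y) → Pred X ℓ → Pred Y (a ⊔ b ⊔ ℓ)
image f S y = ∃ λ x → S x × f x ≡ y

module Submission where

open import Defs
open import Relation.Unary using (_≐_; _⊆_)
open import Data.Product using (_,_)
open import Function.Bundles using (Equivalence)
open import Relation.Binary.PropositionalEquality using (subst; sym)

module _ {a ℓ} {A : ResiduatedLattice a} {L : BoundedDistributiveLattice ℓ}
         {lam : ResiduatedLattice.Carrier A → BoundedDistributiveLattice.Carrier L}
         (R : IsReticulation A L lam) where

  private
    module A = ResiduatedLattice A
    module L = BoundedDistributiveLattice L
  open IsReticulation R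

  image-⟨⟩⊆[⟫ : ∀ x → image lam (A.⟨ x ⟩) ⊆ L.[ lam x ⟫
  image-⟨⟩⊆[⟫ x (y , x^n≤y , lam-y≡l) =
    subst (lam x L.≤_) lam-y≡l (Equivalence.from (order x y) x^n≤y)

  [⟫⊆image-⟨⟩ : ∀ x → L.[ lam x ⟫ ⊆ image lam (A.⟨ x ⟩)
  [⟫⊆image-⟨⟩ x {l} lam-x≤l with surjective l
  ... | y , lam-y≡l =
    y , Equivalence.to (order x y) (subst (lam x L.≤_) (sym lam-y≡l) lam-x≤l) , lam-y≡l

mainTheorem2 : ∀ {a ℓ} (A : ResiduatedLattice a) (L : BoundedDistributiveLattice ℓ)
    (lam : ResiduatedLattice.Carrier A → BoundedDistributiveLattice.Carrier L) →
    IsReticulation A L lam →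
    ∀ x → image lam (ResiduatedLattice.⟨_⟩ A x) ≐ BoundedDistributiveLattice.[_⟫ L (lam x)
mainTheorem2 A L lam R x = image-⟨⟩⊆[⟫ R x , [⟫⊆image-⟨⟩ R x
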